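{- Let $\mathcal{V}$ be a $\ast$-autonomous category whose monoidal unit $I$ is the dualizing object, and let $A$ be a nuclear object of $\mathcal{V}$. Then there exists a morphism $l : [A,A] \to [A,A]^*$ such that $([A,A],\, [A,A]^*,\, ev_{[A,A],I},\, \circ,\, l,\, l)$ is a Frobenius structure, where $\circ : [A,A]\otimes[A,A]\to[A,A]$ is internal composition.
   Context: $\mathcal{V}$ is a symmetric monoidal closed category (taken strict), with tensor $\otimes$, unit $I$, symmetry $\sigma_{X,Y}: X\otimes Y\to Y\otimes X$, unitors $\lambda_X: I\otimes X\to X$, $\rho_X: X\otimes I\to X$, internal hom $[X,Z]$ right adjoint to $X\otimes -$, and evaluation $ev_{X,Z}: X\otimes [X,Z]\to Z$; the transpose of $g: X\otimes Y\to Z$ is the unique $\hat g: Y\to[X,Z]$ with $ev_{X,Z}\circ(X\otimes \hat g)=g$. Put $X^* := [X,I]$ and let $j_X: X\to X^{**}$ be the transpose of $ev_{X,I}\circ\sigma_{X^*,X}$. $\ast$-autonomous means every $j_X$ is an isomorphism. $\mathtt{mix}_{X,Y}: Y^*\otimes X\to [Y,X]$ is the transpose of $\lambda_X\circ(ev_{Y,I}\otimes X)$; $A$ is nuclear if $\mathtt{mix}_{A,A}$ is an isomorphism. Internal composition $\circ:[A,A]\otimes[A,A]\to[A,A]$ is the transpose of $ev_{A,A}\circ(ev_{A,A}\otimes[A,A])$. A dual pairing (w.r.t. an object $0$, here $0=I$) is a morphism $\epsilon: A\otimes B\to 0$ such that for every object $X$ the maps $\hom(X,B)\to\hom(A\otimes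 X,0)$, $f\mapsto \epsilon\circ(A\otimes f)$, and $\hom(X,A)\to\hom(X\otimes B,0)$, $g\mapsto\epsilon\circ(g\otimes B)$, are bijections. Given a dual pairing $\epsilon:A\otimes B\to 0$ and an associative $\mu_A: A\otimes A\to A$, define $\lhd: A\otimes B\to B$ as the unique map with $\epsilon\circ(A\otimes \lhd)=\epsilon\circ(\mu_A\otimes B)$ (maps $A\otimes A\otimes B\to 0$), and $\rhd: B\otimes A\to B$ as the unique map with $\epsilon\circ(A\otimes\rhd)=\epsilon\circ(\mu_A\otimes B)\circ\sigma_{A\otimes B,A}$ (maps $A\otimes B\otimes A\to 0$). A Frobenius structure is a tuple $(A,B,\epsilon,\mu_A,l,r)$ where $\epsilon:A\otimes B\to 0$ is a dual pairing, $\mu_A$ is associative, $l,r: A\to B$ are isomorphisms with $\epsilon\circ(A\otimes r)=\epsilon\circ(A\otimes l)\circ\sigma_{A,A}$, and $\lhd\circ(A\otimes r)=\rhd\circ(l\otimes A): A\otimes A\to B$. -}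

module Defs where

open import Level using (Level; _⊔_) renaming (suc to lsuc)
open import Data.Product using (Σ; Σ-syntax; _×_; _,_)
open import Relation.Binary.Structures using (IsEquivalence)

record SMCC (o ℓ e : Level) : Set (lsuc (o ⊔ ℓ ⊔ e)) where
  infixr 9 _∘_
  infixr 10 _⊗₁_
  infixr 10 _⊗₀_
  infix 4 _≈_
  infix 5 _⇒_
  field
    Obj : Set o
    _⇒_ : Obj → Obj → Set ℓ
    _≈_ : ∀ {X Y} → X ⇒ Y → X ⇒ Y → Set e
    ≈-equiv : ∀ {X Y} → IsEquivalence (_≈_ {X} {Y})
    id : ∀ {X} → X ⇒ X
    _∘_ : ∀ {X Y Z} → Y ⇒ Z → X ⇒ Y → X ⇒ Z
    ∘-resp-≈ : ∀ {X Y Z} {f f′ : Y ⇒ Z} {g g′ : X ⇒ Y} →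
               f ≈ f′ → g ≈ g′ → f ∘ g ≈ f′ ∘ g′
    assoc : ∀ {W X Y Z} {f : W ⇒ X} {g : X ⇒ Y} {h : Y ⇒ Z} →
            (h ∘ g) ∘ f ≈ h ∘ (g ∘ f)
    identityˡ : ∀ {X Y} {f : X ⇒ Y} → id ∘ f ≈ f
    identityʳ : ∀ {X Y} {f : X ⇒ Y} → f ∘ id ≈ f

    _⊗₀_ : Obj → Obj → Obj
    _⊗₁_ : ∀ {X Y Z W} → X ⇒ Y → Z ⇒ W → (X ⊗₀ Z) ⇒ (Y ⊗₀ W)
    I : Obj
    ⊗-resp-≈ : ∀ {X Y Z W} {f f′ : X ⇒ Y} {g g′ : Z ⇒ W} →
               f ≈ f′ → g ≈ g′ → f ⊗₁ g ≈ f′ ⊗₁ g′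
    ⊗-identity : ∀ {X Y} → id {X} ⊗₁ id {Y} ≈ id
    ⊗-homomorphism : ∀ {X₁ Y₁ Z₁ X₂ Y₂ Z₂}
                     {f₁ : X₁ ⇒ Y₁} {g₁ : Y₁ ⇒ Z₁} {f₂ : X₂ ⇒ Y₂} {g₂ : Y₂ ⇒ Z₂} →
                     (g₁ ∘ f₁) ⊗₁ (g₂ ∘ f₂) ≈ (g₁ ⊗₁ g₂) ∘ (f₁ ⊗₁ f₂)

    α⇒ : ∀ {X Y Z} → (X ⊗₀ Y) ⊗₀ Z ⇒ X ⊗₀ (Y ⊗₀ Z)
    α⇐ : ∀ {X Y Z} → X ⊗₀ (Y ⊗₀ Z) ⇒ (X ⊗₀ Y) ⊗₀ Z
    α-isoˡ : ∀ {X Y Z} → α⇐ ∘ α⇒ {X} {Y} {Z} ≈ id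
    α-isoʳ : ∀ {X Y Z} → α⇒ ∘ α⇐ {X} {Y} {Z} ≈ id
    α-natural : ∀ {X Y Z X′ Y′ Z′} {f : X ⇒ X′} {g : Y ⇒ Y′} {h : Z ⇒ Z′} →
                α⇒ ∘ ((f ⊗₁ g) ⊗₁ h) ≈ (f ⊗₁ (g ⊗₁ h)) ∘ α⇒
    λ⇒ : ∀ {X} → I ⊗₀ X ⇒ X
    λ⇐ : ∀ {X} → X ⇒ I ⊗₀ X
    λ-isoˡ : ∀ {X} → λ⇐ ∘ λ⇒ {X} ≈ id
    λ-isoʳ : ∀ {X} → λ⇒ ∘ λ⇐ {X} ≈ id
    λ-natural : ∀ {X Y} {f : X ⇒ Y} → λ⇒ ∘ (id ⊗₁ f) ≈ f ∘ λ⇒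
    ρ⇒ : ∀ {X} → X ⊗₀ I ⇒ X
    ρ⇐ : ∀ {X} → X ⇒ X ⊗₀ I
    ρ-isoˡ : ∀ {X} → ρ⇐ ∘ ρ⇒ {X} ≈ id
    ρ-isoʳ : ∀ {X} → ρ⇒ ∘ ρ⇐ {X} ≈ id
    ρ-natural : ∀ {X Y} {f : X ⇒ Y} → ρ⇒ ∘ (f ⊗₁ id) ≈ f ∘ ρ⇒
    pentagon : ∀ {X Y Z W} →
               α⇒ {X} {Y} {Z ⊗₀ W} ∘ α⇒ {X ⊗₀ Y} {Z} {W}
               ≈ (id ⊗₁ α⇒) ∘ (α⇒ {X} {Y ⊗₀ Z} {W} ∘ (α⇒ ⊗₁ id))
    triangle : ∀ {X Y} → (id {X} ⊗₁ λ⇒ {Y}) ∘ α⇒ ≈ ρ⇒ ⊗₁ id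

    σ : ∀ {X Y} → X ⊗₀ Y ⇒ Y ⊗₀ X
    σ-natural : ∀ {X Y X′ Y′} {f : X ⇒ X′} {g : Y ⇒ Y′} →
                σ ∘ (f ⊗₁ g) ≈ (g ⊗₁ f) ∘ σ
    σ-involutive : ∀ {X Y} → σ {Y} {X} ∘ σ {X} {Y} ≈ id
    hexagon : ∀ {X Y Z} →
              α⇒ {Y} {Z} {X} ∘ (σ {X} {Y ⊗₀ Z} ∘ α⇒ {X} {Y} {Z})
              ≈ (id ⊗₁ σ) ∘ (α⇒ {Y} {X} {Z} ∘ (σ ⊗₁ id))

    [_,_] : Obj → Obj → Obj
    ev : ∀ {X Z} → X ⊗₀ [ X , Z ] ⇒ Z
    curry : ∀ {X Y Z} → X ⊗₀ Y ⇒ Z → Y ⇒ [ X , Z ]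
    curry-β : ∀ {X Y Z} {g : X ⊗₀ Y ⇒ Z} → ev ∘ (id ⊗₁ curry g) ≈ g
    curry-unique : ∀ {X Y Z} {g : X ⊗₀ Y ⇒ Z} {h : Y ⇒ [ X , Z ]} →
                   ev ∘ (id ⊗₁ h) ≈ g → h ≈ curry g

module _ {o ℓ e : Level} (𝒱 : SMCC o ℓ e) where
  open SMCC 𝒱

  IsIso : ∀ {X Y} → X ⇒ Y → Set (ℓ ⊔ e)
  IsIso {X} {Y} f = Σ[ g ∈ Y ⇒ X ] ((g ∘ f ≈ id) × (f ∘ g ≈ id))

  infix 30 _*
  _* : Obj → Obj
  X * = [ X , I ]

  j : ∀ X → X ⇒ (X *) *
  j X = curry (ev {X} {I} ∘ σ {X *} {X})

  StarAutonomous : Set (o ⊔ ℓ ⊔ e)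
  StarAutonomous = ∀ X → IsIso (j X)

  mix : ∀ X Y → (Y *) ⊗₀ X ⇒ [ Y , X ]
  mix X Y = curry (λ⇒ ∘ ((ev {Y} {I} ⊗₁ id {X}) ∘ α⇐))

  Nuclear : Obj → Set (ℓ ⊔ e)
  Nuclear A = IsIso (mix A A)

  icomp : ∀ A → [ A , A ] ⊗₀ [ A , A ] ⇒ [ A , A ]
  icomp A = curry (ev {A} {A} ∘ ((ev {A} {A} ⊗₁ id) ∘ α⇐))

  record IsDualPairing {A B O : Obj} (ε : A ⊗₀ B ⇒ O) : Set (o ⊔ ℓ ⊔ e) where
    field
      right-surj : ∀ {X} (g : A ⊗₀ X ⇒ O) → Σ[ f ∈ X ⇒ B ] (ε ∘ (id ⊗₁ f) ≈ g)
      right-inj  : ∀ {X} (f f′ : X ⇒ B) → ε ∘ (id ⊗₁ f) ≈ ε ∘ (id ⊗₁ f′) → f ≈ f′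
      left-surj  : ∀ {X} (h : X ⊗₀ B ⇒ O) → Σ[ g ∈ X ⇒ A ] (ε ∘ (g ⊗₁ id) ≈ h)
      left-inj   : ∀ {X} (g g′ : X ⇒ A) → ε ∘ (g ⊗₁ id) ≈ ε ∘ (g′ ⊗₁ id) → g ≈ g′

  IsAssociative : ∀ {A} → A ⊗₀ A ⇒ A → Set e
  IsAssociative μ = μ ∘ (μ ⊗₁ id) ≈ μ ∘ ((id ⊗₁ μ) ∘ α⇒)

  IsLeftAction : ∀ {A B O} → A ⊗₀ B ⇒ O → A ⊗₀ A ⇒ A → A ⊗₀ B ⇒ B → Set e
  IsLeftAction ε μ ◁ = ε ∘ (id ⊗₁ ◁) ≈ ε ∘ ((μ ⊗₁ id) ∘ α⇐)

  -- defining property of ▷ : B ⊗ A → B  (maps A⊗(B⊗A) → 0):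
  -- ε ∘ (A ⊗ ▷) = ε ∘ (μ ⊗ B) ∘ σ_{A⊗B,A}, with associators inserted
  IsRightAction : ∀ {A B O} → A ⊗₀ B ⇒ O → A ⊗₀ A ⇒ A → B ⊗₀ A ⇒ B → Set e
  IsRightAction {A} {B} ε μ ▷ =
    ε ∘ (id ⊗₁ ▷) ≈ ε ∘ ((μ ⊗₁ id) ∘ (α⇐ ∘ (σ {A ⊗₀ B} {A} ∘ α⇐)))

  record IsFrobeniusStructure {A B O : Obj} (ε : A ⊗₀ B ⇒ O) (μ : A ⊗₀ A ⇒ A)
                              (l r : A ⇒ B) : Set (o ⊔ ℓ ⊔ e) where
    field
      dualPairing : IsDualPairing ε
      associative : IsAssociative μ
      l-iso : IsIso l
      r-iso : IsIso r
      lr-compat : ε ∘ (id ⊗₁ r) ≈ ε ∘ ((id ⊗₁ l) ∘ σ {A} {A})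
      -- ◁ ∘ (A ⊗ r) = ▷ ∘ (l ⊗ A), for the (unique) ◁, ▷ defined above
      action-compat : ∀ (◁ : A ⊗₀ B ⇒ B) (▷ : B ⊗₀ A ⇒ B) →
                      IsLeftAction ε μ ◁ → IsRightAction ε μ ▷ →
                      ◁ ∘ (id ⊗₁ r) ≈ ▷ ∘ (l ⊗₁ id)

{-# OPTIONS --safe #-}
-- Write β(f, g) = ⟨f , l g⟩ for the form on End = [A , A] induced by l : End → End*. Nuclearity
-- identifies End with A* ⊗ A, hence with its own dual, and the resulting l makes β the trace form,
-- with β(mix(a* ⊗ a), g) = a*(g a). Invariance β(μ(f, g), h) = β(f, μ(g, h)) only has to be checked
-- on such rank-one f, where both sides are a*(h (g a)). Together with the unit of μ it gives
-- β = trace ∘ μ, where trace(mix(a* ⊗ a)) = a*(a); then β(g, mix(a* ⊗ a)) = trace(mix((a* ∘ g) ⊗ a))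
-- = a*(g a) as well, so β is symmetric. A symmetric invariant form whose l is invertible is exactly
-- a Frobenius structure with l = r, and ev is a dual pairing because End is reflexive.
module Submission where

open import Defs
open import Level using (Level)
open import Data.Product using (Σ; Σ-syntax; _,_; proj₁; proj₂)
open import Relation.Binary.Bundles using (Setoid)
open import Relation.Binary.Structures using (IsEquivalence)
import Relation.Binary.Reasoning.Setoid as SetoidReasoning

module Categorical {o ℓ e : Level} (𝒱 : SMCC o ℓ e) where
  open SMCC 𝒱 public

  hom-setoid : Obj → Obj → Setoid ℓ e
  hom-setoid X Y = record { Carrier = X ⇒ Y ; _≈_ = _≈_ ; isEquivalence = ≈-equiv }

  module _ {X Y : Obj} where
    open IsEquivalence (≈-equiv {X} {Y}) public
      renaming (refl to ≈-refl; sym to ≈-sym; trans to ≈-trans)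
    open SetoidReasoning (hom-setoid X Y) public

  infixr 4 _⟩∘⟨_ _⟩⊗⟨_ refl⟩∘⟨_
  infixl 5 _⟩∘⟨refl

  _⟩∘⟨_ : ∀ {X Y Z} {f f′ : Y ⇒ Z} {g g′ : X ⇒ Y} → f ≈ f′ → g ≈ g′ → f ∘ g ≈ f′ ∘ g′
  _⟩∘⟨_ = ∘-resp-≈

  _⟩⊗⟨_ : ∀ {X Y Z W} {f f′ : X ⇒ Y} {g g′ : Z ⇒ W} → f ≈ f′ → g ≈ g′ → f ⊗₁ g ≈ f′ ⊗₁ g′
  _⟩⊗⟨_ = ⊗-resp-≈

  refl⟩∘⟨_ : ∀ {X Y Z} {f : Y ⇒ Z} {g g′ : X ⇒ Y} → g ≈ g′ → f ∘ g ≈ f ∘ g′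
  refl⟩∘⟨ p = ≈-refl ⟩∘⟨ p

  _⟩∘⟨refl : ∀ {X Y Z} {f f′ : Y ⇒ Z} {g : X ⇒ Y} → f ≈ f′ → f ∘ g ≈ f′ ∘ g
  p ⟩∘⟨refl = p ⟩∘⟨ ≈-refl

  pullˡ : ∀ {W X Y Z} {a : Y ⇒ Z} {b : X ⇒ Y} {c : X ⇒ Z} {f : W ⇒ X} →
          a ∘ b ≈ c → a ∘ (b ∘ f) ≈ c ∘ f
  pullˡ p = ≈-trans (≈-sym assoc) (p ⟩∘⟨refl)

  cancelˡ : ∀ {W X Y} {a : Y ⇒ X} {b : X ⇒ Y} {f : W ⇒ X} → a ∘ b ≈ id → a ∘ (b ∘ f) ≈ f
  cancelˡ p = ≈-trans (pullˡ p) identityˡ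

  assoc² : ∀ {V W X Y Z} {f : V ⇒ W} {g : W ⇒ X} {h : X ⇒ Y} {k : Y ⇒ Z} →
           (k ∘ h ∘ g) ∘ f ≈ k ∘ h ∘ g ∘ f
  assoc² = ≈-trans assoc (refl⟩∘⟨ assoc)

  homomorphismˡ : ∀ {X Y Z W} {f : Y ⇒ Z} {g : X ⇒ Y} →
                  (f ∘ g) ⊗₁ id {W} ≈ (f ⊗₁ id) ∘ (g ⊗₁ id)
  homomorphismˡ = ≈-trans (≈-refl ⟩⊗⟨ ≈-sym identityˡ) ⊗-homomorphism

  homomorphismʳ : ∀ {X Y Z W} {f : Y ⇒ Z} {g : X ⇒ Y} →
                  id {W} ⊗₁ (f ∘ g) ≈ (id ⊗₁ f) ∘ (id ⊗₁ g)
  homomorphismʳ = ≈-trans (≈-sym identityˡ ⟩⊗⟨ ≈-refl) ⊗-homomorphism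

  ⊗-slide : ∀ {X Y Z W} {f : X ⇒ Y} {g : Z ⇒ W} →
            (f ⊗₁ id) ∘ (id ⊗₁ g) ≈ (id ⊗₁ g) ∘ (f ⊗₁ id)
  ⊗-slide = begin
    (_ ⊗₁ id) ∘ (id ⊗₁ _) ≈⟨ ⊗-homomorphism ⟨
    (_ ∘ id) ⊗₁ (id ∘ _)   ≈⟨ ≈-trans identityʳ (≈-sym identityˡ) ⟩⊗⟨ ≈-trans identityˡ (≈-sym identityʳ) ⟩
    (id ∘ _) ⊗₁ (_ ∘ id)   ≈⟨ ⊗-homomorphism ⟩
    (id ⊗₁ _) ∘ (_ ⊗₁ id) ∎

  split-epi-cancel : ∀ {W X Y} {a : W ⇒ X} {a′ : X ⇒ W} {f g : X ⇒ Y} →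
                     a ∘ a′ ≈ id → f ∘ a ≈ g ∘ a → f ≈ g
  split-epi-cancel {a = a} {a′} {f} {g} aa′ p = begin
    f              ≈⟨ identityʳ ⟨
    f ∘ id         ≈⟨ refl⟩∘⟨ aa′ ⟨
    f ∘ a ∘ a′     ≈⟨ pullˡ p ⟩
    (g ∘ a) ∘ a′   ≈⟨ assoc ⟩
    g ∘ a ∘ a′     ≈⟨ refl⟩∘⟨ aa′ ⟩
    g ∘ id         ≈⟨ identityʳ ⟩
    g              ∎

  split-mono-cancel : ∀ {W X Y} {a : X ⇒ Y} {a′ : Y ⇒ X} {f g : W ⇒ X} →
                      a′ ∘ a ≈ id → a ∘ f ≈ a ∘ g → f ≈ g
  split-mono-cancel {a = a} {a′} {f} {g} a′a p = begin
    f             ≈⟨ cancelˡ a′a ⟨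
    a′ ∘ a ∘ f    ≈⟨ refl⟩∘⟨ p ⟩
    a′ ∘ a ∘ g    ≈⟨ cancelˡ a′a ⟩
    g             ∎

  inverse-unique : ∀ {X Y} {x y : X ⇒ Y} {x′ y′ : Y ⇒ X} →
                   x ≈ y → x′ ∘ x ≈ id → y ∘ y′ ≈ id → x′ ≈ y′
  inverse-unique {x = x} {y} {x′} {y′} x≈y x′x yy′ = begin
    x′            ≈⟨ identityʳ ⟨
    x′ ∘ id       ≈⟨ refl⟩∘⟨ yy′ ⟨
    x′ ∘ y ∘ y′   ≈⟨ refl⟩∘⟨ x≈y ⟩∘⟨refl ⟨
    x′ ∘ x ∘ y′   ≈⟨ cancelˡ x′x ⟩
    y′            ∎

  conjugate : ∀ {X Y X′ Y′} {a : X ⇒ X′} {a′ : X′ ⇒ X} {b : Y ⇒ Y′} {b′ : Y′ ⇒ Y}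
              {x : X ⇒ Y} {y : X′ ⇒ Y′} →
              b′ ∘ b ≈ id → a ∘ a′ ≈ id → b ∘ x ≈ y ∘ a → b′ ∘ y ≈ x ∘ a′
  conjugate {a = a} {a′} {b} {b′} {x} {y} b′b aa′ p = begin
    b′ ∘ y                ≈⟨ identityʳ ⟨
    (b′ ∘ y) ∘ id         ≈⟨ refl⟩∘⟨ aa′ ⟨
    (b′ ∘ y) ∘ a ∘ a′     ≈⟨ assoc ⟩
    b′ ∘ y ∘ a ∘ a′       ≈⟨ refl⟩∘⟨ pullˡ (≈-sym p) ⟩
    b′ ∘ (b ∘ x) ∘ a′     ≈⟨ refl⟩∘⟨ assoc ⟩
    b′ ∘ b ∘ x ∘ a′       ≈⟨ cancelˡ b′b ⟩
    x ∘ a′                ∎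

  inverse-∘ : ∀ {X Y Z} {a : Y ⇒ Z} {a′ : Z ⇒ Y} {b : X ⇒ Y} {b′ : Y ⇒ X} →
              a′ ∘ a ≈ id → b′ ∘ b ≈ id → (b′ ∘ a′) ∘ (a ∘ b) ≈ id
  inverse-∘ a′a b′b = ≈-trans assoc (≈-trans (refl⟩∘⟨ cancelˡ a′a) b′b)

  inverse-⊗id : ∀ {X Y W} {f : X ⇒ Y} {g : Y ⇒ X} → g ∘ f ≈ id → (g ⊗₁ id {W}) ∘ (f ⊗₁ id) ≈ id
  inverse-⊗id p = ≈-trans (≈-sym homomorphismˡ) (≈-trans (p ⟩⊗⟨ ≈-refl) ⊗-identity)

  inverse-id⊗ : ∀ {X Y W} {f : X ⇒ Y} {g : Y ⇒ X} → g ∘ f ≈ id → (id {W} ⊗₁ g) ∘ (id ⊗₁ f) ≈ id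
  inverse-id⊗ p = ≈-trans (≈-sym homomorphismʳ) (≈-trans (≈-refl ⟩⊗⟨ p) ⊗-identity)

  IsIso-∘ : ∀ {X Y Z} {f : Y ⇒ Z} {g : X ⇒ Y} → IsIso 𝒱 f → IsIso 𝒱 g → IsIso 𝒱 (f ∘ g)
  IsIso-∘ (f⁻¹ , f⁻¹f , ff⁻¹) (g⁻¹ , g⁻¹g , gg⁻¹) =
    g⁻¹ ∘ f⁻¹ , inverse-∘ f⁻¹f g⁻¹g , inverse-∘ gg⁻¹ ff⁻¹

  inverse-∘₃ : ∀ {W X Y Z} {a : Y ⇒ Z} {a′ : Z ⇒ Y} {b : X ⇒ Y} {b′ : Y ⇒ X} {c : W ⇒ X} {c′ : X ⇒ W} →
               a′ ∘ a ≈ id → b′ ∘ b ≈ id → c′ ∘ c ≈ id → (c′ ∘ b′ ∘ a′) ∘ (a ∘ b ∘ c) ≈ id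
  inverse-∘₃ a′a b′b c′c = ≈-trans assoc (≈-trans (refl⟩∘⟨ ≈-trans assoc (refl⟩∘⟨ cancelˡ a′a)) (≈-trans (refl⟩∘⟨ cancelˡ b′b) c′c))

module Coherence {o ℓ e : Level} (𝒱 : SMCC o ℓ e) where
  open Categorical 𝒱

  α⇐-natural : ∀ {X Y Z X′ Y′ Z′} {f : X ⇒ X′} {g : Y ⇒ Y′} {h : Z ⇒ Z′} →
               α⇐ ∘ (f ⊗₁ (g ⊗₁ h)) ≈ ((f ⊗₁ g) ⊗₁ h) ∘ α⇐
  α⇐-natural = conjugate α-isoˡ α-isoʳ α-natural

  ρ⇐-natural : ∀ {X Y} {f : X ⇒ Y} → ρ⇐ ∘ f ≈ (f ⊗₁ id) ∘ ρ⇐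
  ρ⇐-natural = conjugate ρ-isoˡ ρ-isoʳ ρ-natural

  α⇒-naturalˡ : ∀ {X X′ Y Z} {f : X ⇒ X′} → α⇒ ∘ ((f ⊗₁ id {Y}) ⊗₁ id {Z}) ≈ (f ⊗₁ id) ∘ α⇒
  α⇒-naturalˡ = ≈-trans α-natural ((≈-refl ⟩⊗⟨ ⊗-identity) ⟩∘⟨refl)

  α⇐-naturalˡ : ∀ {X X′ Y Z} {f : X ⇒ X′} → α⇐ ∘ (f ⊗₁ id {Y ⊗₀ Z}) ≈ ((f ⊗₁ id) ⊗₁ id) ∘ α⇐
  α⇐-naturalˡ = ≈-trans (refl⟩∘⟨ (≈-refl ⟩⊗⟨ ≈-sym ⊗-identity)) α⇐-natural

  α⇒-naturalʳ : ∀ {X Y Z Z′} {h : Z ⇒ Z′} → α⇒ ∘ (id {X ⊗₀ Y} ⊗₁ h) ≈ (id ⊗₁ (id ⊗₁ h)) ∘ α⇒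
  α⇒-naturalʳ = ≈-trans (refl⟩∘⟨ (≈-sym ⊗-identity ⟩⊗⟨ ≈-refl)) α-natural

  α⇐-naturalʳ : ∀ {X Y Z Z′} {h : Z ⇒ Z′} → α⇐ ∘ (id {X} ⊗₁ (id {Y} ⊗₁ h)) ≈ (id ⊗₁ h) ∘ α⇐
  α⇐-naturalʳ = ≈-trans α⇐-natural ((⊗-identity ⟩⊗⟨ ≈-refl) ⟩∘⟨refl)

  id⊗-faithful : ∀ {X Y} {f g : X ⇒ Y} → id {I} ⊗₁ f ≈ id ⊗₁ g → f ≈ g
  id⊗-faithful p = split-epi-cancel λ-isoʳ (≈-trans (≈-sym λ-natural) (≈-trans (refl⟩∘⟨ p) λ-natural))

  ⊗id-faithful : ∀ {X Y} {f g : X ⇒ Y} → f ⊗₁ id {I} ≈ g ⊗₁ id → f ≈ g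
  ⊗id-faithful p = split-epi-cancel ρ-isoʳ (≈-trans (≈-sym ρ-natural) (≈-trans (refl⟩∘⟨ p) ρ-natural))

  -- Kelly: precompose with the iso α⇒ ∘ (α⇒ ⊗ id) and compare through the pentagon and triangle.
  unitorˡ-α⇒ : ∀ {X Y} → λ⇒ {X ⊗₀ Y} ∘ α⇒ {I} {X} {Y} ≈ λ⇒ ⊗₁ id
  unitorˡ-α⇒ = id⊗-faithful (split-epi-cancel (inverse-∘ (inverse-⊗id α-isoʳ) α-isoʳ) (begin
    (id ⊗₁ (λ⇒ ∘ α⇒)) ∘ α⇒ ∘ (α⇒ ⊗₁ id)              ≈⟨ homomorphismʳ ⟩∘⟨refl ⟩
    ((id ⊗₁ λ⇒) ∘ (id ⊗₁ α⇒)) ∘ α⇒ ∘ (α⇒ ⊗₁ id)      ≈⟨ assoc ⟩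
    (id ⊗₁ λ⇒) ∘ (id ⊗₁ α⇒) ∘ α⇒ ∘ (α⇒ ⊗₁ id)        ≈⟨ refl⟩∘⟨ pentagon ⟨
    (id ⊗₁ λ⇒) ∘ α⇒ ∘ α⇒                              ≈⟨ pullˡ triangle ⟩
    (ρ⇒ ⊗₁ id) ∘ α⇒                                   ≈⟨ (≈-refl ⟩⊗⟨ ⊗-identity) ⟩∘⟨refl ⟨
    (ρ⇒ ⊗₁ (id ⊗₁ id)) ∘ α⇒                           ≈⟨ α-natural ⟨
    α⇒ ∘ ((ρ⇒ ⊗₁ id) ⊗₁ id)                           ≈⟨ refl⟩∘⟨ (triangle ⟩⊗⟨ ≈-refl) ⟨
    α⇒ ∘ (((id ⊗₁ λ⇒) ∘ α⇒) ⊗₁ id)                    ≈⟨ refl⟩∘⟨ homomorphismˡ ⟩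
    α⇒ ∘ ((id ⊗₁ λ⇒) ⊗₁ id) ∘ (α⇒ ⊗₁ id)              ≈⟨ pullˡ α-natural ⟩
    ((id ⊗₁ (λ⇒ ⊗₁ id)) ∘ α⇒) ∘ (α⇒ ⊗₁ id)           ≈⟨ assoc ⟩
    (id ⊗₁ (λ⇒ ⊗₁ id)) ∘ α⇒ ∘ (α⇒ ⊗₁ id)             ∎))

  unitorʳ-α⇒ : ∀ {X Y} → (id {X} ⊗₁ ρ⇒ {Y}) ∘ α⇒ ≈ ρ⇒
  unitorʳ-α⇒ = ≈-sym (⊗id-faithful (split-mono-cancel α-isoˡ (begin
    α⇒ ∘ (ρ⇒ ⊗₁ id)                                    ≈⟨ refl⟩∘⟨ triangle ⟨
    α⇒ ∘ (id ⊗₁ λ⇒) ∘ α⇒                               ≈⟨ refl⟩∘⟨ (⊗-identity ⟩⊗⟨ ≈-refl) ⟩∘⟨refl ⟨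
    α⇒ ∘ ((id ⊗₁ id) ⊗₁ λ⇒) ∘ α⇒                       ≈⟨ pullˡ α-natural ⟩
    ((id ⊗₁ (id ⊗₁ λ⇒)) ∘ α⇒) ∘ α⇒                     ≈⟨ assoc ⟩
    (id ⊗₁ (id ⊗₁ λ⇒)) ∘ α⇒ ∘ α⇒                       ≈⟨ refl⟩∘⟨ pentagon ⟩
    (id ⊗₁ (id ⊗₁ λ⇒)) ∘ (id ⊗₁ α⇒) ∘ α⇒ ∘ (α⇒ ⊗₁ id) ≈⟨ pullˡ (≈-sym homomorphismʳ) ⟩
    (id ⊗₁ ((id ⊗₁ λ⇒) ∘ α⇒)) ∘ α⇒ ∘ (α⇒ ⊗₁ id)       ≈⟨ (≈-refl ⟩⊗⟨ triangle) ⟩∘⟨refl ⟩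
    (id ⊗₁ (ρ⇒ ⊗₁ id)) ∘ α⇒ ∘ (α⇒ ⊗₁ id)              ≈⟨ pullˡ (≈-sym α-natural) ⟩
    (α⇒ ∘ ((id ⊗₁ ρ⇒) ⊗₁ id)) ∘ (α⇒ ⊗₁ id)            ≈⟨ assoc ⟩
    α⇒ ∘ ((id ⊗₁ ρ⇒) ⊗₁ id) ∘ (α⇒ ⊗₁ id)              ≈⟨ refl⟩∘⟨ homomorphismˡ ⟨
    α⇒ ∘ (((id ⊗₁ ρ⇒) ∘ α⇒) ⊗₁ id)                    ∎)))

  unitorʳ-α⇐ : ∀ {X Y} → ρ⇒ ∘ α⇐ ≈ id {X} ⊗₁ ρ⇒ {Y}
  unitorʳ-α⇐ = ≈-trans (≈-sym unitorʳ-α⇒ ⟩∘⟨refl) (≈-trans assoc (≈-trans (refl⟩∘⟨ α-isoʳ) identityʳ))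

  α⇐-id⊗ρ⇐ : ∀ {X Y} → α⇐ ∘ (id {X} ⊗₁ ρ⇐ {Y}) ≈ ρ⇐
  α⇐-id⊗ρ⇐ = begin
    α⇐ ∘ (id ⊗₁ ρ⇐)               ≈⟨ cancelˡ ρ-isoˡ ⟨
    ρ⇐ ∘ ρ⇒ ∘ α⇐ ∘ (id ⊗₁ ρ⇐)     ≈⟨ refl⟩∘⟨ pullˡ unitorʳ-α⇐ ⟩
    ρ⇐ ∘ (id ⊗₁ ρ⇒) ∘ (id ⊗₁ ρ⇐)  ≈⟨ refl⟩∘⟨ inverse-id⊗ ρ-isoʳ ⟩
    ρ⇐ ∘ id                        ≈⟨ identityʳ ⟩
    ρ⇐                             ∎

  α⇐-id⊗[id⊗h∘ρ⇐] : ∀ {X Y Z} {h : I ⇒ Z} → α⇐ ∘ (id {X} ⊗₁ ((id {Y} ⊗₁ h) ∘ ρ⇐)) ≈ (id ⊗₁ h) ∘ ρ⇐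
  α⇐-id⊗[id⊗h∘ρ⇐] = begin
    α⇐ ∘ (id ⊗₁ ((id ⊗₁ _) ∘ ρ⇐))          ≈⟨ refl⟩∘⟨ homomorphismʳ ⟩
    α⇐ ∘ (id ⊗₁ (id ⊗₁ _)) ∘ (id ⊗₁ ρ⇐)    ≈⟨ pullˡ α⇐-naturalʳ ⟩
    ((id ⊗₁ _) ∘ α⇐) ∘ (id ⊗₁ ρ⇐)          ≈⟨ assoc ⟩
    (id ⊗₁ _) ∘ α⇐ ∘ (id ⊗₁ ρ⇐)            ≈⟨ refl⟩∘⟨ α⇐-id⊗ρ⇐ ⟩
    (id ⊗₁ _) ∘ ρ⇐                          ∎

  λ⇒⊗id-slide : ∀ {X Y Z} {g : X ⊗₀ Y ⇒ Z} → g ∘ (λ⇒ ⊗₁ id) ≈ λ⇒ ∘ (id ⊗₁ g) ∘ α⇒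
  λ⇒⊗id-slide {g = g} = begin
    g ∘ (λ⇒ ⊗₁ id)           ≈⟨ refl⟩∘⟨ unitorˡ-α⇒ ⟨
    g ∘ λ⇒ ∘ α⇒              ≈⟨ pullˡ (≈-sym λ-natural) ⟩
    (λ⇒ ∘ (id ⊗₁ g)) ∘ α⇒    ≈⟨ assoc ⟩
    λ⇒ ∘ (id ⊗₁ g) ∘ α⇒      ∎

  pentagon-inv : ∀ {X Y Z W} →
                 α⇐ {X ⊗₀ Y} {Z} {W} ∘ α⇐ {X} {Y} {Z ⊗₀ W} ≈ (α⇐ ⊗₁ id) ∘ α⇐ ∘ (id ⊗₁ α⇐)
  pentagon-inv = inverse-unique pentagon (inverse-∘ α-isoˡ α-isoˡ)
                   (inverse-∘₃ (inverse-⊗id α-isoʳ) α-isoʳ (inverse-id⊗ α-isoʳ))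

  α⇒∘α⇐⊗id∘α⇐ : ∀ {X Y Z W} →
                α⇒ {X ⊗₀ Y} {Z} {W} ∘ (α⇐ ⊗₁ id) ∘ α⇐ {X} {Y ⊗₀ Z} {W} ≈ α⇐ ∘ (id ⊗₁ α⇒)
  α⇒∘α⇐⊗id∘α⇐ = begin
    α⇒ ∘ (α⇐ ⊗₁ id) ∘ α⇐                                    ≈⟨ identityʳ ⟨
    (α⇒ ∘ (α⇐ ⊗₁ id) ∘ α⇐) ∘ id                             ≈⟨ refl⟩∘⟨ inverse-id⊗ α-isoˡ ⟨
    (α⇒ ∘ (α⇐ ⊗₁ id) ∘ α⇐) ∘ (id ⊗₁ α⇐) ∘ (id ⊗₁ α⇒)       ≈⟨ assoc² ⟩
    α⇒ ∘ (α⇐ ⊗₁ id) ∘ α⇐ ∘ (id ⊗₁ α⇐) ∘ (id ⊗₁ α⇒)         ≈⟨ refl⟩∘⟨ refl⟩∘⟨ assoc ⟨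
    α⇒ ∘ (α⇐ ⊗₁ id) ∘ (α⇐ ∘ (id ⊗₁ α⇐)) ∘ (id ⊗₁ α⇒)       ≈⟨ refl⟩∘⟨ assoc ⟨
    α⇒ ∘ ((α⇐ ⊗₁ id) ∘ α⇐ ∘ (id ⊗₁ α⇐)) ∘ (id ⊗₁ α⇒)       ≈⟨ refl⟩∘⟨ pentagon-inv ⟩∘⟨refl ⟨
    α⇒ ∘ (α⇐ ∘ α⇐) ∘ (id ⊗₁ α⇒)                             ≈⟨ refl⟩∘⟨ assoc ⟩
    α⇒ ∘ α⇐ ∘ α⇐ ∘ (id ⊗₁ α⇒)                               ≈⟨ cancelˡ α-isoʳ ⟩
    α⇐ ∘ (id ⊗₁ α⇒)                                          ∎

  α⇐∘α⇐∘id⊗α⇒ : ∀ {X Y Z W} →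
                α⇐ {X ⊗₀ Y} {Z} {W} ∘ α⇐ ∘ (id ⊗₁ α⇒) ≈ (α⇐ ⊗₁ id) ∘ α⇐
  α⇐∘α⇐∘id⊗α⇒ = ≈-trans (refl⟩∘⟨ ≈-sym α⇒∘α⇐⊗id∘α⇐) (cancelˡ α-isoˡ)

  hexagon-inv : ∀ {X Y Z} →
                α⇐ {Z} {X} {Y} ∘ σ {X ⊗₀ Y} {Z} ∘ α⇐ {X} {Y} {Z} ≈ (σ ⊗₁ id) ∘ α⇐ ∘ (id ⊗₁ σ)
  hexagon-inv = inverse-unique hexagon (inverse-∘₃ α-isoˡ σ-involutive α-isoˡ)
                  (inverse-∘₃ (inverse-⊗id σ-involutive) α-isoʳ (inverse-id⊗ σ-involutive))

  -- Both sides send (x ⊗ y) ⊗ z to (y ⊗ z) ⊗ x: rotating twice to the right is rotating once to the left.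
  rotate-twice : ∀ {X Y Z} →
                 α⇐ {Y} {Z} {X} ∘ σ {Z ⊗₀ X} {Y} ∘ α⇐ {Z} {X} {Y} ∘ σ {X ⊗₀ Y} {Z} ≈ σ {X} {Y ⊗₀ Z} ∘ α⇒
  rotate-twice = begin
    α⇐ ∘ σ ∘ α⇐ ∘ σ                                                     ≈⟨ assoc ⟨
    (α⇐ ∘ σ) ∘ α⇐ ∘ σ                                                   ≈⟨ α⇐∘σ ⟩∘⟨refl ⟩
    ((σ ⊗₁ id) ∘ (α⇐ ∘ (id ⊗₁ σ)) ∘ α⇒) ∘ α⇐ ∘ σ                       ≈⟨ assoc² ⟩
    (σ ⊗₁ id) ∘ (α⇐ ∘ (id ⊗₁ σ)) ∘ α⇒ ∘ α⇐ ∘ σ                         ≈⟨ refl⟩∘⟨ refl⟩∘⟨ cancelˡ α-isoʳ ⟩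
    (σ ⊗₁ id) ∘ (α⇐ ∘ (id ⊗₁ σ)) ∘ σ                                   ≈⟨ refl⟩∘⟨ assoc ⟩
    (σ ⊗₁ id) ∘ α⇐ ∘ (id ⊗₁ σ) ∘ σ                                     ≈⟨ refl⟩∘⟨ refl⟩∘⟨ σ-natural ⟨
    (σ ⊗₁ id) ∘ α⇐ ∘ σ ∘ (σ ⊗₁ id)                                     ≈⟨ refl⟩∘⟨ pullˡ α⇐∘σ ⟩
    (σ ⊗₁ id) ∘ ((σ ⊗₁ id) ∘ (α⇐ ∘ (id ⊗₁ σ)) ∘ α⇒) ∘ (σ ⊗₁ id)       ≈⟨ refl⟩∘⟨ assoc ⟩
    (σ ⊗₁ id) ∘ (σ ⊗₁ id) ∘ ((α⇐ ∘ (id ⊗₁ σ)) ∘ α⇒) ∘ (σ ⊗₁ id)       ≈⟨ cancelˡ (inverse-⊗id σ-involutive) ⟩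
    ((α⇐ ∘ (id ⊗₁ σ)) ∘ α⇒) ∘ (σ ⊗₁ id)                                ≈⟨ ≈-trans assoc assoc ⟩
    α⇐ ∘ (id ⊗₁ σ) ∘ α⇒ ∘ (σ ⊗₁ id)                                    ≈⟨ refl⟩∘⟨ hexagon ⟨
    α⇐ ∘ α⇒ ∘ σ ∘ α⇒                                                   ≈⟨ cancelˡ α-isoˡ ⟩
    σ ∘ α⇒                                                              ∎
    where
    α⇐∘σ : ∀ {X Y Z} → α⇐ ∘ σ {X ⊗₀ Y} {Z} ≈ (σ ⊗₁ id) ∘ (α⇐ ∘ (id ⊗₁ σ)) ∘ α⇒
    α⇐∘σ = begin
      α⇐ ∘ σ                                   ≈⟨ identityʳ ⟨
      (α⇐ ∘ σ) ∘ id                            ≈⟨ refl⟩∘⟨ α-isoˡ ⟨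
      (α⇐ ∘ σ) ∘ α⇐ ∘ α⇒                       ≈⟨ assoc ⟩
      α⇐ ∘ σ ∘ α⇐ ∘ α⇒                         ≈⟨ refl⟩∘⟨ assoc ⟨
      α⇐ ∘ (σ ∘ α⇐) ∘ α⇒                       ≈⟨ assoc ⟨
      (α⇐ ∘ σ ∘ α⇐) ∘ α⇒                       ≈⟨ hexagon-inv ⟩∘⟨refl ⟩
      ((σ ⊗₁ id) ∘ α⇐ ∘ (id ⊗₁ σ)) ∘ α⇒        ≈⟨ assoc ⟩
      (σ ⊗₁ id) ∘ (α⇐ ∘ (id ⊗₁ σ)) ∘ α⇒        ∎

module Closed {o ℓ e : Level} (𝒱 : SMCC o ℓ e) where
  open Categorical 𝒱
  open Coherence 𝒱

  ev-ext : ∀ {X Y Z} {f g : Y ⇒ [ X , Z ]} → ev ∘ (id ⊗₁ f) ≈ ev ∘ (id ⊗₁ g) → f ≈ g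
  ev-ext p = ≈-trans (curry-unique p) (≈-sym (curry-unique ≈-refl))

  curry-resp-≈ : ∀ {X Y Z} {g g′ : X ⊗₀ Y ⇒ Z} → g ≈ g′ → curry g ≈ curry g′
  curry-resp-≈ p = curry-unique (≈-trans curry-β p)

  curry-β-∘ : ∀ {W X Y Z} {h : X ⊗₀ Y ⇒ Z} {g : W ⇒ Y} → ev ∘ (id ⊗₁ (curry h ∘ g)) ≈ h ∘ (id ⊗₁ g)
  curry-β-∘ = ≈-trans (refl⟩∘⟨ homomorphismʳ) (pullˡ curry-β)

  postcomp : ∀ {X Y Y′} → Y ⇒ Y′ → [ X , Y ] ⇒ [ X , Y′ ]
  postcomp f = curry (f ∘ ev)

  precomp : ∀ {X X′ Z} → X ⇒ X′ → [ X′ , Z ] ⇒ [ X , Z ]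
  precomp f = curry (ev ∘ (f ⊗₁ id))

  postcomp-∘ : ∀ {X Y Y′ Y″} {f : Y′ ⇒ Y″} {g : Y ⇒ Y′} → postcomp {X} f ∘ postcomp g ≈ postcomp (f ∘ g)
  postcomp-∘ {f = f} {g} = ev-ext (begin
    ev ∘ (id ⊗₁ (postcomp f ∘ postcomp g))          ≈⟨ refl⟩∘⟨ homomorphismʳ ⟩
    ev ∘ (id ⊗₁ postcomp f) ∘ (id ⊗₁ postcomp g)    ≈⟨ pullˡ curry-β ⟩
    (f ∘ ev) ∘ (id ⊗₁ postcomp g)                   ≈⟨ assoc ⟩
    f ∘ ev ∘ (id ⊗₁ postcomp g)                     ≈⟨ refl⟩∘⟨ curry-β ⟩
    f ∘ g ∘ ev                                      ≈⟨ assoc ⟨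
    (f ∘ g) ∘ ev                                    ≈⟨ curry-β ⟨
    ev ∘ (id ⊗₁ postcomp (f ∘ g))                   ∎)

  postcomp-id : ∀ {X Y} → postcomp {X} (id {Y}) ≈ id
  postcomp-id = ev-ext (≈-trans curry-β (≈-trans identityˡ (≈-sym (≈-trans (refl⟩∘⟨ ⊗-identity) identityʳ))))

  precomp-∘ : ∀ {X X′ X″ Z} {f : X ⇒ X′} {g : X′ ⇒ X″} → precomp {Z = Z} f ∘ precomp g ≈ precomp (g ∘ f)
  precomp-∘ {f = f} {g} = ev-ext (begin
    ev ∘ (id ⊗₁ (precomp f ∘ precomp g))         ≈⟨ refl⟩∘⟨ homomorphismʳ ⟩
    ev ∘ (id ⊗₁ precomp f) ∘ (id ⊗₁ precomp g)   ≈⟨ pullˡ curry-β ⟩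
    (ev ∘ (f ⊗₁ id)) ∘ (id ⊗₁ precomp g)         ≈⟨ assoc ⟩
    ev ∘ (f ⊗₁ id) ∘ (id ⊗₁ precomp g)           ≈⟨ refl⟩∘⟨ ⊗-slide ⟩
    ev ∘ (id ⊗₁ precomp g) ∘ (f ⊗₁ id)           ≈⟨ pullˡ curry-β ⟩
    (ev ∘ (g ⊗₁ id)) ∘ (f ⊗₁ id)                 ≈⟨ assoc ⟩
    ev ∘ (g ⊗₁ id) ∘ (f ⊗₁ id)                   ≈⟨ refl⟩∘⟨ homomorphismˡ ⟨
    ev ∘ ((g ∘ f) ⊗₁ id)                         ≈⟨ curry-β ⟨
    ev ∘ (id ⊗₁ precomp (g ∘ f))                 ∎)

  precomp-id : ∀ {X Z} → precomp {Z = Z} (id {X}) ≈ id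
  precomp-id = ev-ext curry-β

  postcomp-iso : ∀ {X Y Y′} {f : Y ⇒ Y′} → IsIso 𝒱 f → IsIso 𝒱 (postcomp {X} f)
  postcomp-iso (f⁻¹ , f⁻¹f , ff⁻¹) = postcomp f⁻¹ , inverse f⁻¹f , inverse ff⁻¹
    where
    inverse : ∀ {Y Y′} {g : Y ⇒ Y′} {h : Y′ ⇒ Y} → h ∘ g ≈ id → postcomp h ∘ postcomp g ≈ id
    inverse hg = ≈-trans postcomp-∘ (≈-trans (curry-resp-≈ (hg ⟩∘⟨refl)) postcomp-id)

  precomp-iso : ∀ {X X′ Z} {f : X ⇒ X′} → IsIso 𝒱 f → IsIso 𝒱 (precomp {Z = Z} f)
  precomp-iso (f⁻¹ , f⁻¹f , ff⁻¹) = precomp f⁻¹ , inverse ff⁻¹ , inverse f⁻¹f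
    where
    inverse : ∀ {X X′} {g : X ⇒ X′} {h : X′ ⇒ X} → g ∘ h ≈ id → precomp h ∘ precomp g ≈ id
    inverse gh = ≈-trans precomp-∘ (≈-trans (curry-resp-≈ (refl⟩∘⟨ (gh ⟩⊗⟨ ≈-refl))) precomp-id)

  uncurry : ∀ {X Y Z} → [ Y , [ X , Z ] ] ⇒ [ X ⊗₀ Y , Z ]
  uncurry = curry (ev ∘ (id ⊗₁ ev) ∘ α⇒)

  uncurry-iso : ∀ {X Y Z} → IsIso 𝒱 (uncurry {X} {Y} {Z})
  uncurry-iso = curry (curry (ev ∘ α⇐)) , recurry-uncurry , uncurry-recurry
    where
    recurry-uncurry : curry (curry (ev ∘ α⇐)) ∘ uncurry ≈ id
    recurry-uncurry = ev-ext (ev-ext (begin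
      ev ∘ (id ⊗₁ (ev ∘ (id ⊗₁ (curry (curry (ev ∘ α⇐)) ∘ uncurry))))
        ≈⟨ refl⟩∘⟨ (≈-refl ⟩⊗⟨ ≈-trans (refl⟩∘⟨ homomorphismʳ) (pullˡ curry-β)) ⟩
      ev ∘ (id ⊗₁ (curry (ev ∘ α⇐) ∘ (id ⊗₁ uncurry)))         ≈⟨ refl⟩∘⟨ homomorphismʳ ⟩
      ev ∘ (id ⊗₁ curry (ev ∘ α⇐)) ∘ (id ⊗₁ (id ⊗₁ uncurry))   ≈⟨ pullˡ curry-β ⟩
      (ev ∘ α⇐) ∘ (id ⊗₁ (id ⊗₁ uncurry))                      ≈⟨ assoc ⟩
      ev ∘ α⇐ ∘ (id ⊗₁ (id ⊗₁ uncurry))                        ≈⟨ refl⟩∘⟨ α⇐-natural ⟩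
      ev ∘ ((id ⊗₁ id) ⊗₁ uncurry) ∘ α⇐                        ≈⟨ refl⟩∘⟨ (⊗-identity ⟩⊗⟨ ≈-refl) ⟩∘⟨refl ⟩
      ev ∘ (id ⊗₁ uncurry) ∘ α⇐                                ≈⟨ pullˡ curry-β ⟩
      (ev ∘ (id ⊗₁ ev) ∘ α⇒) ∘ α⇐                              ≈⟨ assoc² ⟩
      ev ∘ (id ⊗₁ ev) ∘ α⇒ ∘ α⇐                                ≈⟨ refl⟩∘⟨ refl⟩∘⟨ α-isoʳ ⟩
      ev ∘ (id ⊗₁ ev) ∘ id                                     ≈⟨ refl⟩∘⟨ identityʳ ⟩
      ev ∘ (id ⊗₁ ev)                                          ≈⟨ refl⟩∘⟨ (≈-refl ⟩⊗⟨ ≈-trans (refl⟩∘⟨ ⊗-identity) identityʳ) ⟨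
      ev ∘ (id ⊗₁ (ev ∘ (id ⊗₁ id)))                           ∎))
    uncurry-recurry : uncurry ∘ curry (curry (ev ∘ α⇐)) ≈ id
    uncurry-recurry = ev-ext (begin
      ev ∘ (id ⊗₁ (uncurry ∘ curry (curry (ev ∘ α⇐))))                ≈⟨ refl⟩∘⟨ homomorphismʳ ⟩
      ev ∘ (id ⊗₁ uncurry) ∘ (id ⊗₁ curry (curry (ev ∘ α⇐)))          ≈⟨ pullˡ curry-β ⟩
      (ev ∘ (id ⊗₁ ev) ∘ α⇒) ∘ (id ⊗₁ curry (curry (ev ∘ α⇐)))        ≈⟨ assoc² ⟩
      ev ∘ (id ⊗₁ ev) ∘ α⇒ ∘ (id ⊗₁ curry (curry (ev ∘ α⇐)))          ≈⟨ refl⟩∘⟨ refl⟩∘⟨ α⇒-naturalʳ ⟩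
      ev ∘ (id ⊗₁ ev) ∘ (id ⊗₁ (id ⊗₁ curry (curry (ev ∘ α⇐)))) ∘ α⇒  ≈⟨ refl⟩∘⟨ pullˡ (≈-sym homomorphismʳ) ⟩
      ev ∘ (id ⊗₁ (ev ∘ (id ⊗₁ curry (curry (ev ∘ α⇐))))) ∘ α⇒        ≈⟨ refl⟩∘⟨ (≈-refl ⟩⊗⟨ curry-β) ⟩∘⟨refl ⟩
      ev ∘ (id ⊗₁ curry (ev ∘ α⇐)) ∘ α⇒                               ≈⟨ pullˡ curry-β ⟩
      (ev ∘ α⇐) ∘ α⇒                                                  ≈⟨ assoc ⟩
      ev ∘ α⇐ ∘ α⇒                                                    ≈⟨ refl⟩∘⟨ α-isoˡ ⟩
      ev ∘ id                                                         ≈⟨ refl⟩∘⟨ ⊗-identity ⟨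
      ev ∘ (id ⊗₁ id)                                                 ∎)

  ev-isDualPairing : ∀ {X} → IsIso 𝒱 (j 𝒱 X) → IsDualPairing 𝒱 (ev {X} {I})
  ev-isDualPairing {X} (j⁻¹ , j⁻¹j , jj⁻¹) = record
    { right-surj = λ g → curry g , curry-β
    ; right-inj  = λ _ _ → ev-ext
    ; left-surj  = λ h → j⁻¹ ∘ curry (h ∘ σ) ,
        split-epi-cancel σ-involutive (begin
          (ev ∘ ((j⁻¹ ∘ curry (h ∘ σ)) ⊗₁ id)) ∘ σ   ≈⟨ ev-j (j⁻¹ ∘ curry (h ∘ σ)) ⟨
          ev ∘ (id ⊗₁ (j 𝒱 X ∘ j⁻¹ ∘ curry (h ∘ σ)))  ≈⟨ refl⟩∘⟨ (≈-refl ⟩⊗⟨ cancelˡ jj⁻¹) ⟩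
          ev ∘ (id ⊗₁ curry (h ∘ σ))                   ≈⟨ curry-β ⟩
          h ∘ σ                                        ∎)
    ; left-inj   = λ g g′ p → split-mono-cancel j⁻¹j
        (ev-ext (≈-trans (ev-j g) (≈-trans (p ⟩∘⟨refl) (≈-sym (ev-j g′)))))
    }
    where
    ev-j : ∀ {W} (g : W ⇒ X) → ev ∘ (id ⊗₁ (j 𝒱 X ∘ g)) ≈ (ev ∘ (g ⊗₁ id)) ∘ σ
    ev-j g = begin
      ev ∘ (id ⊗₁ (j 𝒱 X ∘ g))   ≈⟨ curry-β-∘ ⟩
      (ev ∘ σ) ∘ (id ⊗₁ g)       ≈⟨ assoc ⟩
      ev ∘ σ ∘ (id ⊗₁ g)         ≈⟨ refl⟩∘⟨ σ-natural ⟩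
      ev ∘ (g ⊗₁ id) ∘ σ         ≈⟨ assoc ⟨
      (ev ∘ (g ⊗₁ id)) ∘ σ       ∎

module FrobeniusForm {o ℓ e : Level} (𝒱 : SMCC o ℓ e) where
  open Categorical 𝒱
  open Coherence 𝒱
  open Closed 𝒱

  form : ∀ {C} → C ⇒ [ C , I ] → C ⊗₀ C ⇒ I
  form l = ev ∘ (id ⊗₁ l)

  IsSymmetricForm : ∀ {C} → C ⊗₀ C ⇒ I → Set e
  IsSymmetricForm β = β ∘ σ ≈ β

  IsInvariantForm : ∀ {C} → C ⊗₀ C ⇒ C → C ⊗₀ C ⇒ I → Set e
  IsInvariantForm μ β = β ∘ (μ ⊗₁ id) ≈ β ∘ (id ⊗₁ μ) ∘ α⇒

  module _ {C : Obj} {μ : C ⊗₀ C ⇒ C} {l : C ⇒ [ C , I ]}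
           (symmetric : IsSymmetricForm (form l)) (invariant : IsInvariantForm μ (form l)) where

    left-action-form : ∀ {◁ : C ⊗₀ [ C , I ] ⇒ [ C , I ]} → IsLeftAction 𝒱 ev μ ◁ →
                       ev ∘ (id ⊗₁ (◁ ∘ (id ⊗₁ l))) ≈ form l ∘ (id ⊗₁ μ) ∘ σ ∘ α⇐
    left-action-form {◁} ◁-def = begin
      ev ∘ (id ⊗₁ (◁ ∘ (id ⊗₁ l)))                    ≈⟨ refl⟩∘⟨ homomorphismʳ ⟩
      ev ∘ (id ⊗₁ ◁) ∘ (id ⊗₁ (id ⊗₁ l))              ≈⟨ pullˡ ◁-def ⟩
      (ev ∘ (μ ⊗₁ id) ∘ α⇐) ∘ (id ⊗₁ (id ⊗₁ l))       ≈⟨ assoc² ⟩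
      ev ∘ (μ ⊗₁ id) ∘ α⇐ ∘ (id ⊗₁ (id ⊗₁ l))         ≈⟨ refl⟩∘⟨ refl⟩∘⟨ α⇐-naturalʳ ⟩
      ev ∘ (μ ⊗₁ id) ∘ (id ⊗₁ l) ∘ α⇐                 ≈⟨ refl⟩∘⟨ ≈-trans (pullˡ ⊗-slide) assoc ⟩
      ev ∘ (id ⊗₁ l) ∘ (μ ⊗₁ id) ∘ α⇐                 ≈⟨ assoc ⟨
      form l ∘ (μ ⊗₁ id) ∘ α⇐                          ≈⟨ symmetric ⟩∘⟨refl ⟨
      (form l ∘ σ) ∘ (μ ⊗₁ id) ∘ α⇐                    ≈⟨ assoc ⟩
      form l ∘ σ ∘ (μ ⊗₁ id) ∘ α⇐                      ≈⟨ refl⟩∘⟨ ≈-trans (pullˡ σ-natural) assoc ⟩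
      form l ∘ (id ⊗₁ μ) ∘ σ ∘ α⇐                      ∎

    right-action-form : ∀ {▷ : [ C , I ] ⊗₀ C ⇒ [ C , I ]} → IsRightAction 𝒱 ev μ ▷ →
                        ev ∘ (id ⊗₁ (▷ ∘ (l ⊗₁ id))) ≈ form l ∘ (id ⊗₁ μ) ∘ σ ∘ α⇐
    right-action-form {▷} ▷-def = begin
      ev ∘ (id ⊗₁ (▷ ∘ (l ⊗₁ id)))                                ≈⟨ refl⟩∘⟨ homomorphismʳ ⟩
      ev ∘ (id ⊗₁ ▷) ∘ (id ⊗₁ (l ⊗₁ id))                          ≈⟨ pullˡ ▷-def ⟩
      (ev ∘ (μ ⊗₁ id) ∘ α⇐ ∘ σ ∘ α⇐) ∘ (id ⊗₁ (l ⊗₁ id))          ≈⟨ ≈-trans assoc² (refl⟩∘⟨ refl⟩∘⟨ assoc²) ⟩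
      ev ∘ (μ ⊗₁ id) ∘ α⇐ ∘ σ ∘ α⇐ ∘ (id ⊗₁ (l ⊗₁ id))            ≈⟨ refl⟩∘⟨ refl⟩∘⟨ refl⟩∘⟨ refl⟩∘⟨ α⇐-natural ⟩
      ev ∘ (μ ⊗₁ id) ∘ α⇐ ∘ σ ∘ ((id ⊗₁ l) ⊗₁ id) ∘ α⇐            ≈⟨ refl⟩∘⟨ refl⟩∘⟨ refl⟩∘⟨ ≈-trans (pullˡ σ-natural) assoc ⟩
      ev ∘ (μ ⊗₁ id) ∘ α⇐ ∘ (id ⊗₁ (id ⊗₁ l)) ∘ σ ∘ α⇐            ≈⟨ refl⟩∘⟨ refl⟩∘⟨ ≈-trans (pullˡ α⇐-naturalʳ) assoc ⟩
      ev ∘ (μ ⊗₁ id) ∘ (id ⊗₁ l) ∘ α⇐ ∘ σ ∘ α⇐                    ≈⟨ refl⟩∘⟨ ≈-trans (pullˡ ⊗-slide) assoc ⟩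
      ev ∘ (id ⊗₁ l) ∘ (μ ⊗₁ id) ∘ α⇐ ∘ σ ∘ α⇐                    ≈⟨ ≈-trans (≈-sym assoc) (≈-sym assoc) ⟩
      (form l ∘ (μ ⊗₁ id)) ∘ α⇐ ∘ σ ∘ α⇐                          ≈⟨ invariant ⟩∘⟨refl ⟩
      (form l ∘ (id ⊗₁ μ) ∘ α⇒) ∘ α⇐ ∘ σ ∘ α⇐                     ≈⟨ assoc² ⟩
      form l ∘ (id ⊗₁ μ) ∘ α⇒ ∘ α⇐ ∘ σ ∘ α⇐                       ≈⟨ refl⟩∘⟨ refl⟩∘⟨ cancelˡ α-isoʳ ⟩
      form l ∘ (id ⊗₁ μ) ∘ σ ∘ α⇐                                 ∎

    frobenius-from-form : IsIso 𝒱 (j 𝒱 C) → IsAssociative 𝒱 μ → IsIso 𝒱 l →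
                          IsFrobeniusStructure 𝒱 ev μ l l
    frobenius-from-form C-reflexive μ-assoc l-iso = record
      { dualPairing   = ev-isDualPairing C-reflexive
      ; associative   = μ-assoc
      ; l-iso         = l-iso
      ; r-iso         = l-iso
      ; lr-compat     = ≈-sym (≈-trans (≈-sym assoc) symmetric)
      ; action-compat = λ _ _ ◁-def ▷-def →
          ev-ext (≈-trans (left-action-form ◁-def) (≈-sym (right-action-form ▷-def)))
      }

module Endomorphisms {o ℓ e : Level} (𝒱 : SMCC o ℓ e) (A : SMCC.Obj 𝒱) where
  open Categorical 𝒱
  open Coherence 𝒱
  open Closed 𝒱

  End : Obj
  End = [ A , A ]

  -- Diagrammatic order: μ sends f ⊗ g to "first f, then g".
  μ : End ⊗₀ End ⇒ End
  μ = icomp 𝒱 A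

  icomp-assoc : IsAssociative 𝒱 μ
  icomp-assoc = ev-ext (≈-trans left (≈-sym right))
    where
    normal-form : A ⊗₀ (End ⊗₀ End) ⊗₀ End ⇒ A
    normal-form = ev ∘ (ev ⊗₁ id) ∘ ((ev ⊗₁ id) ⊗₁ id) ∘ (α⇐ ⊗₁ id) ∘ α⇐
    left : ev ∘ (id ⊗₁ (μ ∘ (μ ⊗₁ id))) ≈ normal-form
    left = begin
      ev ∘ (id ⊗₁ (μ ∘ (μ ⊗₁ id)))                                  ≈⟨ curry-β-∘ ⟩
      (ev ∘ (ev ⊗₁ id) ∘ α⇐) ∘ (id ⊗₁ (μ ⊗₁ id))                    ≈⟨ assoc² ⟩
      ev ∘ (ev ⊗₁ id) ∘ α⇐ ∘ (id ⊗₁ (μ ⊗₁ id))                      ≈⟨ refl⟩∘⟨ refl⟩∘⟨ α⇐-natural ⟩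
      ev ∘ (ev ⊗₁ id) ∘ ((id ⊗₁ μ) ⊗₁ id) ∘ α⇐                      ≈⟨ refl⟩∘⟨ pullˡ (≈-sym homomorphismˡ) ⟩
      ev ∘ ((ev ∘ (id ⊗₁ μ)) ⊗₁ id) ∘ α⇐                            ≈⟨ refl⟩∘⟨ (curry-β ⟩⊗⟨ ≈-refl) ⟩∘⟨refl ⟩
      ev ∘ ((ev ∘ (ev ⊗₁ id) ∘ α⇐) ⊗₁ id) ∘ α⇐                      ≈⟨ refl⟩∘⟨ ≈-trans homomorphismˡ (refl⟩∘⟨ homomorphismˡ) ⟩∘⟨refl ⟩
      ev ∘ ((ev ⊗₁ id) ∘ ((ev ⊗₁ id) ⊗₁ id) ∘ (α⇐ ⊗₁ id)) ∘ α⇐      ≈⟨ refl⟩∘⟨ assoc² ⟩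
      normal-form                                                   ∎
    right : ev ∘ (id ⊗₁ (μ ∘ (id ⊗₁ μ) ∘ α⇒)) ≈ normal-form
    right = begin
      ev ∘ (id ⊗₁ (μ ∘ (id ⊗₁ μ) ∘ α⇒))                              ≈⟨ curry-β-∘ ⟩
      (ev ∘ (ev ⊗₁ id) ∘ α⇐) ∘ (id ⊗₁ ((id ⊗₁ μ) ∘ α⇒))              ≈⟨ assoc² ⟩
      ev ∘ (ev ⊗₁ id) ∘ α⇐ ∘ (id ⊗₁ ((id ⊗₁ μ) ∘ α⇒))                ≈⟨ refl⟩∘⟨ refl⟩∘⟨ refl⟩∘⟨ homomorphismʳ ⟩
      ev ∘ (ev ⊗₁ id) ∘ α⇐ ∘ (id ⊗₁ (id ⊗₁ μ)) ∘ (id ⊗₁ α⇒)          ≈⟨ refl⟩∘⟨ refl⟩∘⟨ ≈-trans (pullˡ α⇐-naturalʳ) assoc ⟩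
      ev ∘ (ev ⊗₁ id) ∘ (id ⊗₁ μ) ∘ α⇐ ∘ (id ⊗₁ α⇒)                  ≈⟨ refl⟩∘⟨ ≈-trans (pullˡ ⊗-slide) assoc ⟩
      ev ∘ (id ⊗₁ μ) ∘ (ev ⊗₁ id) ∘ α⇐ ∘ (id ⊗₁ α⇒)                  ≈⟨ pullˡ curry-β ⟩
      (ev ∘ (ev ⊗₁ id) ∘ α⇐) ∘ (ev ⊗₁ id) ∘ α⇐ ∘ (id ⊗₁ α⇒)          ≈⟨ assoc² ⟩
      ev ∘ (ev ⊗₁ id) ∘ α⇐ ∘ (ev ⊗₁ id) ∘ α⇐ ∘ (id ⊗₁ α⇒)            ≈⟨ refl⟩∘⟨ refl⟩∘⟨ ≈-trans (pullˡ α⇐-naturalˡ) assoc ⟩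
      ev ∘ (ev ⊗₁ id) ∘ ((ev ⊗₁ id) ⊗₁ id) ∘ α⇐ ∘ α⇐ ∘ (id ⊗₁ α⇒)    ≈⟨ refl⟩∘⟨ refl⟩∘⟨ refl⟩∘⟨ α⇐∘α⇐∘id⊗α⇒ ⟩
      normal-form                                                    ∎


  ⌜id⌝ : I ⇒ End
  ⌜id⌝ = curry ρ⇒

  icomp-unitʳ : μ ∘ (id ⊗₁ ⌜id⌝) ≈ ρ⇒
  icomp-unitʳ = ev-ext (begin
    ev ∘ (id ⊗₁ (μ ∘ (id ⊗₁ ⌜id⌝)))                ≈⟨ curry-β-∘ ⟩
    (ev ∘ (ev ⊗₁ id) ∘ α⇐) ∘ (id ⊗₁ (id ⊗₁ ⌜id⌝))  ≈⟨ assoc² ⟩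
    ev ∘ (ev ⊗₁ id) ∘ α⇐ ∘ (id ⊗₁ (id ⊗₁ ⌜id⌝))    ≈⟨ refl⟩∘⟨ refl⟩∘⟨ α⇐-naturalʳ ⟩
    ev ∘ (ev ⊗₁ id) ∘ (id ⊗₁ ⌜id⌝) ∘ α⇐            ≈⟨ refl⟩∘⟨ ≈-trans (pullˡ ⊗-slide) assoc ⟩
    ev ∘ (id ⊗₁ ⌜id⌝) ∘ (ev ⊗₁ id) ∘ α⇐            ≈⟨ pullˡ curry-β ⟩
    ρ⇒ ∘ (ev ⊗₁ id) ∘ α⇐                           ≈⟨ ≈-trans (pullˡ ρ-natural) assoc ⟩
    ev ∘ ρ⇒ ∘ α⇐                                   ≈⟨ refl⟩∘⟨ unitorʳ-α⇐ ⟩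
    ev ∘ (id ⊗₁ ρ⇒)                                ∎)

  mixᴬ : [ A , I ] ⊗₀ A ⇒ End
  mixᴬ = mix 𝒱 A A

  icomp-mixˡ : μ ∘ (mixᴬ ⊗₁ id) ≈ mixᴬ ∘ (id ⊗₁ ev) ∘ α⇒
  icomp-mixˡ = ev-ext (≈-trans left (≈-sym right))
    where
    normal-form : A ⊗₀ ([ A , I ] ⊗₀ A) ⊗₀ End ⇒ A
    normal-form = λ⇒ ∘ (id ⊗₁ ev) ∘ (ev ⊗₁ id) ∘ α⇐ ∘ (id ⊗₁ α⇒)
    left : ev ∘ (id ⊗₁ (μ ∘ (mixᴬ ⊗₁ id))) ≈ normal-form
    left = begin
      ev ∘ (id ⊗₁ (μ ∘ (mixᴬ ⊗₁ id)))                                 ≈⟨ curry-β-∘ ⟩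
      (ev ∘ (ev ⊗₁ id) ∘ α⇐) ∘ (id ⊗₁ (mixᴬ ⊗₁ id))                   ≈⟨ assoc² ⟩
      ev ∘ (ev ⊗₁ id) ∘ α⇐ ∘ (id ⊗₁ (mixᴬ ⊗₁ id))                     ≈⟨ refl⟩∘⟨ refl⟩∘⟨ α⇐-natural ⟩
      ev ∘ (ev ⊗₁ id) ∘ ((id ⊗₁ mixᴬ) ⊗₁ id) ∘ α⇐                     ≈⟨ refl⟩∘⟨ pullˡ (≈-sym homomorphismˡ) ⟩
      ev ∘ ((ev ∘ (id ⊗₁ mixᴬ)) ⊗₁ id) ∘ α⇐                           ≈⟨ refl⟩∘⟨ (curry-β ⟩⊗⟨ ≈-refl) ⟩∘⟨refl ⟩
      ev ∘ ((λ⇒ ∘ (ev ⊗₁ id) ∘ α⇐) ⊗₁ id) ∘ α⇐                        ≈⟨ refl⟩∘⟨ ≈-trans homomorphismˡ (refl⟩∘⟨ homomorphismˡ) ⟩∘⟨refl ⟩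
      ev ∘ ((λ⇒ ⊗₁ id) ∘ ((ev ⊗₁ id) ⊗₁ id) ∘ (α⇐ ⊗₁ id)) ∘ α⇐        ≈⟨ refl⟩∘⟨ assoc ⟩
      ev ∘ (λ⇒ ⊗₁ id) ∘ (((ev ⊗₁ id) ⊗₁ id) ∘ (α⇐ ⊗₁ id)) ∘ α⇐        ≈⟨ pullˡ λ⇒⊗id-slide ⟩
      (λ⇒ ∘ (id ⊗₁ ev) ∘ α⇒) ∘ (((ev ⊗₁ id) ⊗₁ id) ∘ (α⇐ ⊗₁ id)) ∘ α⇐ ≈⟨ assoc² ⟩
      λ⇒ ∘ (id ⊗₁ ev) ∘ α⇒ ∘ (((ev ⊗₁ id) ⊗₁ id) ∘ (α⇐ ⊗₁ id)) ∘ α⇐   ≈⟨ refl⟩∘⟨ refl⟩∘⟨ refl⟩∘⟨ assoc ⟩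
      λ⇒ ∘ (id ⊗₁ ev) ∘ α⇒ ∘ ((ev ⊗₁ id) ⊗₁ id) ∘ (α⇐ ⊗₁ id) ∘ α⇐     ≈⟨ refl⟩∘⟨ refl⟩∘⟨ ≈-trans (pullˡ α⇒-naturalˡ) assoc ⟩
      λ⇒ ∘ (id ⊗₁ ev) ∘ (ev ⊗₁ id) ∘ α⇒ ∘ (α⇐ ⊗₁ id) ∘ α⇐             ≈⟨ refl⟩∘⟨ refl⟩∘⟨ refl⟩∘⟨ α⇒∘α⇐⊗id∘α⇐ ⟩
      normal-form                                                     ∎
    right : ev ∘ (id ⊗₁ (mixᴬ ∘ (id ⊗₁ ev) ∘ α⇒)) ≈ normal-form
    right = begin
      ev ∘ (id ⊗₁ (mixᴬ ∘ (id ⊗₁ ev) ∘ α⇒))                   ≈⟨ curry-β-∘ ⟩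
      (λ⇒ ∘ (ev ⊗₁ id) ∘ α⇐) ∘ (id ⊗₁ ((id ⊗₁ ev) ∘ α⇒))      ≈⟨ assoc² ⟩
      λ⇒ ∘ (ev ⊗₁ id) ∘ α⇐ ∘ (id ⊗₁ ((id ⊗₁ ev) ∘ α⇒))        ≈⟨ refl⟩∘⟨ refl⟩∘⟨ refl⟩∘⟨ homomorphismʳ ⟩
      λ⇒ ∘ (ev ⊗₁ id) ∘ α⇐ ∘ (id ⊗₁ (id ⊗₁ ev)) ∘ (id ⊗₁ α⇒)  ≈⟨ refl⟩∘⟨ refl⟩∘⟨ ≈-trans (pullˡ α⇐-naturalʳ) assoc ⟩
      λ⇒ ∘ (ev ⊗₁ id) ∘ (id ⊗₁ ev) ∘ α⇐ ∘ (id ⊗₁ α⇒)          ≈⟨ refl⟩∘⟨ ≈-trans (pullˡ ⊗-slide) assoc ⟩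
      normal-form                                             ∎

  -- dual-action (f ⊗ a*) = a* ∘ f
  dual-action : End ⊗₀ [ A , I ] ⇒ [ A , I ]
  dual-action = curry (ev ∘ (ev ⊗₁ id) ∘ α⇐)

  icomp-mixʳ : μ ∘ (id ⊗₁ mixᴬ) ≈ mixᴬ ∘ (dual-action ⊗₁ id) ∘ α⇐
  icomp-mixʳ = ev-ext (≈-trans left (≈-sym right))
    where
    normal-form : A ⊗₀ End ⊗₀ [ A , I ] ⊗₀ A ⇒ A
    normal-form = λ⇒ ∘ (ev ⊗₁ id) ∘ ((ev ⊗₁ id) ⊗₁ id) ∘ α⇐ ∘ α⇐
    left : ev ∘ (id ⊗₁ (μ ∘ (id ⊗₁ mixᴬ))) ≈ normal-form
    left = begin
      ev ∘ (id ⊗₁ (μ ∘ (id ⊗₁ mixᴬ)))                  ≈⟨ curry-β-∘ ⟩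
      (ev ∘ (ev ⊗₁ id) ∘ α⇐) ∘ (id ⊗₁ (id ⊗₁ mixᴬ))    ≈⟨ assoc² ⟩
      ev ∘ (ev ⊗₁ id) ∘ α⇐ ∘ (id ⊗₁ (id ⊗₁ mixᴬ))      ≈⟨ refl⟩∘⟨ refl⟩∘⟨ α⇐-naturalʳ ⟩
      ev ∘ (ev ⊗₁ id) ∘ (id ⊗₁ mixᴬ) ∘ α⇐              ≈⟨ refl⟩∘⟨ ≈-trans (pullˡ ⊗-slide) assoc ⟩
      ev ∘ (id ⊗₁ mixᴬ) ∘ (ev ⊗₁ id) ∘ α⇐              ≈⟨ pullˡ curry-β ⟩
      (λ⇒ ∘ (ev ⊗₁ id) ∘ α⇐) ∘ (ev ⊗₁ id) ∘ α⇐         ≈⟨ assoc² ⟩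
      λ⇒ ∘ (ev ⊗₁ id) ∘ α⇐ ∘ (ev ⊗₁ id) ∘ α⇐           ≈⟨ refl⟩∘⟨ refl⟩∘⟨ ≈-trans (pullˡ α⇐-naturalˡ) assoc ⟩
      normal-form                                      ∎
    right : ev ∘ (id ⊗₁ (mixᴬ ∘ (dual-action ⊗₁ id) ∘ α⇐)) ≈ normal-form
    right = begin
      ev ∘ (id ⊗₁ (mixᴬ ∘ (dual-action ⊗₁ id) ∘ α⇐))                        ≈⟨ curry-β-∘ ⟩
      (λ⇒ ∘ (ev ⊗₁ id) ∘ α⇐) ∘ (id ⊗₁ ((dual-action ⊗₁ id) ∘ α⇐))           ≈⟨ assoc² ⟩
      λ⇒ ∘ (ev ⊗₁ id) ∘ α⇐ ∘ (id ⊗₁ ((dual-action ⊗₁ id) ∘ α⇐))             ≈⟨ refl⟩∘⟨ refl⟩∘⟨ refl⟩∘⟨ homomorphismʳ ⟩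
      λ⇒ ∘ (ev ⊗₁ id) ∘ α⇐ ∘ (id ⊗₁ (dual-action ⊗₁ id)) ∘ (id ⊗₁ α⇐)       ≈⟨ refl⟩∘⟨ refl⟩∘⟨ ≈-trans (pullˡ α⇐-natural) assoc ⟩
      λ⇒ ∘ (ev ⊗₁ id) ∘ ((id ⊗₁ dual-action) ⊗₁ id) ∘ α⇐ ∘ (id ⊗₁ α⇐)       ≈⟨ refl⟩∘⟨ pullˡ (≈-sym homomorphismˡ) ⟩
      λ⇒ ∘ ((ev ∘ (id ⊗₁ dual-action)) ⊗₁ id) ∘ α⇐ ∘ (id ⊗₁ α⇐)             ≈⟨ refl⟩∘⟨ (curry-β ⟩⊗⟨ ≈-refl) ⟩∘⟨refl ⟩
      λ⇒ ∘ ((ev ∘ (ev ⊗₁ id) ∘ α⇐) ⊗₁ id) ∘ α⇐ ∘ (id ⊗₁ α⇐)                 ≈⟨ refl⟩∘⟨ ≈-trans homomorphismˡ (refl⟩∘⟨ homomorphismˡ) ⟩∘⟨refl ⟩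
      λ⇒ ∘ ((ev ⊗₁ id) ∘ ((ev ⊗₁ id) ⊗₁ id) ∘ (α⇐ ⊗₁ id)) ∘ α⇐ ∘ (id ⊗₁ α⇐) ≈⟨ refl⟩∘⟨ assoc² ⟩
      λ⇒ ∘ (ev ⊗₁ id) ∘ ((ev ⊗₁ id) ⊗₁ id) ∘ (α⇐ ⊗₁ id) ∘ α⇐ ∘ (id ⊗₁ α⇐)   ≈⟨ refl⟩∘⟨ refl⟩∘⟨ refl⟩∘⟨ pentagon-inv ⟨
      normal-form                                                           ∎

  pairing : [ A , I ] ⊗₀ A ⇒ I
  pairing = ev ∘ σ

  pairing-dual-action : pairing ∘ (dual-action ⊗₁ id) ∘ α⇐ ∘ σ ≈ pairing ∘ (id ⊗₁ ev) ∘ α⇒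
  pairing-dual-action = begin
    (ev ∘ σ) ∘ (dual-action ⊗₁ id) ∘ α⇐ ∘ σ   ≈⟨ assoc ⟩
    ev ∘ σ ∘ (dual-action ⊗₁ id) ∘ α⇐ ∘ σ     ≈⟨ refl⟩∘⟨ ≈-trans (pullˡ σ-natural) assoc ⟩
    ev ∘ (id ⊗₁ dual-action) ∘ σ ∘ α⇐ ∘ σ     ≈⟨ pullˡ curry-β ⟩
    (ev ∘ (ev ⊗₁ id) ∘ α⇐) ∘ σ ∘ α⇐ ∘ σ       ≈⟨ assoc² ⟩
    ev ∘ (ev ⊗₁ id) ∘ α⇐ ∘ σ ∘ α⇐ ∘ σ         ≈⟨ refl⟩∘⟨ refl⟩∘⟨ rotate-twice ⟩
    ev ∘ (ev ⊗₁ id) ∘ σ ∘ α⇒                  ≈⟨ refl⟩∘⟨ ≈-trans (pullˡ σ-natural) assoc ⟨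
    ev ∘ σ ∘ (id ⊗₁ ev) ∘ α⇒                  ≈⟨ assoc ⟨
    (ev ∘ σ) ∘ (id ⊗₁ ev) ∘ α⇒                ∎

module TraceForm {o ℓ e : Level} (𝒱 : SMCC o ℓ e) (A : SMCC.Obj 𝒱)
                 (A-reflexive : IsIso 𝒱 (j 𝒱 A)) (nuclear : Nuclear 𝒱 A) where
  open Categorical 𝒱
  open Coherence 𝒱
  open Closed 𝒱
  open Endomorphisms 𝒱 A
  open FrobeniusForm 𝒱

  private
    mix⁻¹ : End ⇒ [ A , I ] ⊗₀ A
    mix⁻¹ = proj₁ nuclear

    mix⁻¹-mix : mix⁻¹ ∘ mixᴬ ≈ id
    mix⁻¹-mix = proj₁ (proj₂ nuclear)

    mix-mix⁻¹ : mixᴬ ∘ mix⁻¹ ≈ id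
    mix-mix⁻¹ = proj₂ (proj₂ nuclear)

  -- [A , A] ≅ [A , A**] ≅ [A* ⊗ A , I] ≅ [A , A]*, through j A, uncurrying and mix⁻¹.
  l : End ⇒ [ End , I ]
  l = precomp mix⁻¹ ∘ uncurry ∘ postcomp (j 𝒱 A)

  l-iso : IsIso 𝒱 l
  l-iso = IsIso-∘ (precomp-iso (mixᴬ , mix-mix⁻¹ , mix⁻¹-mix)) (IsIso-∘ uncurry-iso (postcomp-iso A-reflexive))

  trace-form-mixˡ : form l ∘ (mixᴬ ⊗₁ id) ≈ pairing ∘ (id ⊗₁ ev) ∘ α⇒
  trace-form-mixˡ = begin
    (ev ∘ (id ⊗₁ l)) ∘ (mixᴬ ⊗₁ id)                                        ≈⟨ assoc ⟩
    ev ∘ (id ⊗₁ l) ∘ (mixᴬ ⊗₁ id)                                          ≈⟨ refl⟩∘⟨ ⊗-slide ⟨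
    ev ∘ (mixᴬ ⊗₁ id) ∘ (id ⊗₁ l)                                          ≈⟨ refl⟩∘⟨ refl⟩∘⟨ homomorphismʳ ⟩
    ev ∘ (mixᴬ ⊗₁ id) ∘ (id ⊗₁ precomp mix⁻¹) ∘ (id ⊗₁ (uncurry ∘ postcomp (j 𝒱 A)))
      ≈⟨ refl⟩∘⟨ ≈-trans (pullˡ ⊗-slide) assoc ⟩
    ev ∘ (id ⊗₁ precomp mix⁻¹) ∘ (mixᴬ ⊗₁ id) ∘ (id ⊗₁ (uncurry ∘ postcomp (j 𝒱 A)))
      ≈⟨ ≈-trans (pullˡ curry-β) assoc ⟩
    ev ∘ (mix⁻¹ ⊗₁ id) ∘ (mixᴬ ⊗₁ id) ∘ (id ⊗₁ (uncurry ∘ postcomp (j 𝒱 A)))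
      ≈⟨ refl⟩∘⟨ cancelˡ (inverse-⊗id mix⁻¹-mix) ⟩
    ev ∘ (id ⊗₁ (uncurry ∘ postcomp (j 𝒱 A)))                              ≈⟨ curry-β-∘ ⟩
    (ev ∘ (id ⊗₁ ev) ∘ α⇒) ∘ (id ⊗₁ postcomp (j 𝒱 A))                      ≈⟨ assoc² ⟩
    ev ∘ (id ⊗₁ ev) ∘ α⇒ ∘ (id ⊗₁ postcomp (j 𝒱 A))                        ≈⟨ refl⟩∘⟨ refl⟩∘⟨ α⇒-naturalʳ ⟩
    ev ∘ (id ⊗₁ ev) ∘ (id ⊗₁ (id ⊗₁ postcomp (j 𝒱 A))) ∘ α⇒                ≈⟨ refl⟩∘⟨ pullˡ (≈-sym homomorphismʳ) ⟩
    ev ∘ (id ⊗₁ (ev ∘ (id ⊗₁ postcomp (j 𝒱 A)))) ∘ α⇒                      ≈⟨ refl⟩∘⟨ (≈-refl ⟩⊗⟨ curry-β) ⟩∘⟨refl ⟩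
    ev ∘ (id ⊗₁ (j 𝒱 A ∘ ev)) ∘ α⇒                                         ≈⟨ refl⟩∘⟨ ≈-trans (homomorphismʳ ⟩∘⟨refl) assoc ⟩
    ev ∘ (id ⊗₁ j 𝒱 A) ∘ (id ⊗₁ ev) ∘ α⇒                                   ≈⟨ pullˡ curry-β ⟩
    pairing ∘ (id ⊗₁ ev) ∘ α⇒                                              ∎

  trace-form-invariant : IsInvariantForm μ (form l)
  trace-form-invariant = split-epi-cancel (inverse-⊗id (inverse-⊗id mix-mix⁻¹)) (≈-trans left (≈-sym right))
    where
    normal-form : (([ A , I ] ⊗₀ A) ⊗₀ End) ⊗₀ End ⇒ I
    normal-form = pairing ∘ (id ⊗₁ ev) ∘ (id ⊗₁ (ev ⊗₁ id)) ∘ α⇒ ∘ (α⇒ ⊗₁ id)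
    left : (form l ∘ (μ ⊗₁ id)) ∘ ((mixᴬ ⊗₁ id) ⊗₁ id) ≈ normal-form
    left = begin
      (form l ∘ (μ ⊗₁ id)) ∘ ((mixᴬ ⊗₁ id) ⊗₁ id)                   ≈⟨ ≈-trans assoc (refl⟩∘⟨ ≈-sym homomorphismˡ) ⟩
      form l ∘ ((μ ∘ (mixᴬ ⊗₁ id)) ⊗₁ id)                           ≈⟨ refl⟩∘⟨ (icomp-mixˡ ⟩⊗⟨ ≈-refl) ⟩
      form l ∘ ((mixᴬ ∘ (id ⊗₁ ev) ∘ α⇒) ⊗₁ id)                     ≈⟨ refl⟩∘⟨ homomorphismˡ ⟩
      form l ∘ (mixᴬ ⊗₁ id) ∘ (((id ⊗₁ ev) ∘ α⇒) ⊗₁ id)             ≈⟨ pullˡ trace-form-mixˡ ⟩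
      (pairing ∘ (id ⊗₁ ev) ∘ α⇒) ∘ (((id ⊗₁ ev) ∘ α⇒) ⊗₁ id)      ≈⟨ assoc² ⟩
      pairing ∘ (id ⊗₁ ev) ∘ α⇒ ∘ (((id ⊗₁ ev) ∘ α⇒) ⊗₁ id)        ≈⟨ refl⟩∘⟨ refl⟩∘⟨ refl⟩∘⟨ homomorphismˡ ⟩
      pairing ∘ (id ⊗₁ ev) ∘ α⇒ ∘ ((id ⊗₁ ev) ⊗₁ id) ∘ (α⇒ ⊗₁ id)  ≈⟨ refl⟩∘⟨ refl⟩∘⟨ ≈-trans (pullˡ α-natural) assoc ⟩
      normal-form                                                  ∎
    right : (form l ∘ (id ⊗₁ μ) ∘ α⇒) ∘ ((mixᴬ ⊗₁ id) ⊗₁ id) ≈ normal-form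
    right = begin
      (form l ∘ (id ⊗₁ μ) ∘ α⇒) ∘ ((mixᴬ ⊗₁ id) ⊗₁ id)                       ≈⟨ assoc² ⟩
      form l ∘ (id ⊗₁ μ) ∘ α⇒ ∘ ((mixᴬ ⊗₁ id) ⊗₁ id)                         ≈⟨ refl⟩∘⟨ refl⟩∘⟨ α⇒-naturalˡ ⟩
      form l ∘ (id ⊗₁ μ) ∘ (mixᴬ ⊗₁ id) ∘ α⇒                                 ≈⟨ refl⟩∘⟨ ≈-trans (pullˡ (≈-sym ⊗-slide)) assoc ⟩
      form l ∘ (mixᴬ ⊗₁ id) ∘ (id ⊗₁ μ) ∘ α⇒                                 ≈⟨ pullˡ trace-form-mixˡ ⟩
      (pairing ∘ (id ⊗₁ ev) ∘ α⇒) ∘ (id ⊗₁ μ) ∘ α⇒                          ≈⟨ assoc² ⟩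
      pairing ∘ (id ⊗₁ ev) ∘ α⇒ ∘ (id ⊗₁ μ) ∘ α⇒                            ≈⟨ refl⟩∘⟨ refl⟩∘⟨ ≈-trans (pullˡ α⇒-naturalʳ) assoc ⟩
      pairing ∘ (id ⊗₁ ev) ∘ (id ⊗₁ (id ⊗₁ μ)) ∘ α⇒ ∘ α⇒                    ≈⟨ refl⟩∘⟨ pullˡ (≈-sym homomorphismʳ) ⟩
      pairing ∘ (id ⊗₁ (ev ∘ (id ⊗₁ μ))) ∘ α⇒ ∘ α⇒                          ≈⟨ refl⟩∘⟨ (≈-refl ⟩⊗⟨ curry-β) ⟩∘⟨refl ⟩
      pairing ∘ (id ⊗₁ (ev ∘ (ev ⊗₁ id) ∘ α⇐)) ∘ α⇒ ∘ α⇒                    ≈⟨ refl⟩∘⟨ ≈-trans homomorphismʳ (refl⟩∘⟨ homomorphismʳ) ⟩∘⟨refl ⟩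
      pairing ∘ ((id ⊗₁ ev) ∘ (id ⊗₁ (ev ⊗₁ id)) ∘ (id ⊗₁ α⇐)) ∘ α⇒ ∘ α⇒    ≈⟨ refl⟩∘⟨ assoc² ⟩
      pairing ∘ (id ⊗₁ ev) ∘ (id ⊗₁ (ev ⊗₁ id)) ∘ (id ⊗₁ α⇐) ∘ α⇒ ∘ α⇒      ≈⟨ refl⟩∘⟨ refl⟩∘⟨ refl⟩∘⟨ refl⟩∘⟨ pentagon ⟩
      pairing ∘ (id ⊗₁ ev) ∘ (id ⊗₁ (ev ⊗₁ id)) ∘ (id ⊗₁ α⇐) ∘ (id ⊗₁ α⇒) ∘ α⇒ ∘ (α⇒ ⊗₁ id)
        ≈⟨ refl⟩∘⟨ refl⟩∘⟨ refl⟩∘⟨ cancelˡ (inverse-id⊗ α-isoˡ) ⟩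
      normal-form                                                           ∎

  trace : End ⇒ I
  trace = form l ∘ (id ⊗₁ ⌜id⌝) ∘ ρ⇐

  -- Invariance moves the unit across: β(f, g) = β(f, μ(g, id)) = β(μ(f, g), id).
  trace-form-via-trace : form l ≈ trace ∘ μ
  trace-form-via-trace = begin
    form l                                                          ≈⟨ identityʳ ⟨
    form l ∘ id                                                     ≈⟨ refl⟩∘⟨ ≈-trans (≈-refl ⟩⊗⟨ right-unit) ⊗-identity ⟨
    form l ∘ (id ⊗₁ (μ ∘ (id ⊗₁ ⌜id⌝) ∘ ρ⇐))                        ≈⟨ refl⟩∘⟨ homomorphismʳ ⟩
    form l ∘ (id ⊗₁ μ) ∘ (id ⊗₁ ((id ⊗₁ ⌜id⌝) ∘ ρ⇐))                ≈⟨ refl⟩∘⟨ refl⟩∘⟨ cancelˡ α-isoʳ ⟨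
    form l ∘ (id ⊗₁ μ) ∘ α⇒ ∘ α⇐ ∘ (id ⊗₁ ((id ⊗₁ ⌜id⌝) ∘ ρ⇐))      ≈⟨ assoc² ⟨
    (form l ∘ (id ⊗₁ μ) ∘ α⇒) ∘ α⇐ ∘ (id ⊗₁ ((id ⊗₁ ⌜id⌝) ∘ ρ⇐))    ≈⟨ trace-form-invariant ⟩∘⟨refl ⟨
    (form l ∘ (μ ⊗₁ id)) ∘ α⇐ ∘ (id ⊗₁ ((id ⊗₁ ⌜id⌝) ∘ ρ⇐))         ≈⟨ assoc ⟩
    form l ∘ (μ ⊗₁ id) ∘ α⇐ ∘ (id ⊗₁ ((id ⊗₁ ⌜id⌝) ∘ ρ⇐))           ≈⟨ refl⟩∘⟨ refl⟩∘⟨ α⇐-id⊗[id⊗h∘ρ⇐] ⟩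
    form l ∘ (μ ⊗₁ id) ∘ (id ⊗₁ ⌜id⌝) ∘ ρ⇐                          ≈⟨ refl⟩∘⟨ ≈-trans (pullˡ ⊗-slide) assoc ⟩
    form l ∘ (id ⊗₁ ⌜id⌝) ∘ (μ ⊗₁ id) ∘ ρ⇐                          ≈⟨ refl⟩∘⟨ refl⟩∘⟨ ρ⇐-natural ⟨
    form l ∘ (id ⊗₁ ⌜id⌝) ∘ ρ⇐ ∘ μ                                  ≈⟨ assoc² ⟨
    trace ∘ μ                                                       ∎
    where
    right-unit : μ ∘ (id ⊗₁ ⌜id⌝) ∘ ρ⇐ ≈ id
    right-unit = ≈-trans (pullˡ icomp-unitʳ) ρ-isoʳ

  trace-mix : trace ∘ mixᴬ ≈ pairing
  trace-mix = begin
    (form l ∘ (id ⊗₁ ⌜id⌝) ∘ ρ⇐) ∘ mixᴬ                   ≈⟨ assoc² ⟩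
    form l ∘ (id ⊗₁ ⌜id⌝) ∘ ρ⇐ ∘ mixᴬ                     ≈⟨ refl⟩∘⟨ refl⟩∘⟨ ρ⇐-natural ⟩
    form l ∘ (id ⊗₁ ⌜id⌝) ∘ (mixᴬ ⊗₁ id) ∘ ρ⇐             ≈⟨ refl⟩∘⟨ ≈-trans (pullˡ (≈-sym ⊗-slide)) assoc ⟩
    form l ∘ (mixᴬ ⊗₁ id) ∘ (id ⊗₁ ⌜id⌝) ∘ ρ⇐             ≈⟨ pullˡ trace-form-mixˡ ⟩
    (pairing ∘ (id ⊗₁ ev) ∘ α⇒) ∘ (id ⊗₁ ⌜id⌝) ∘ ρ⇐       ≈⟨ assoc² ⟩
    pairing ∘ (id ⊗₁ ev) ∘ α⇒ ∘ (id ⊗₁ ⌜id⌝) ∘ ρ⇐         ≈⟨ refl⟩∘⟨ refl⟩∘⟨ ≈-trans (pullˡ α⇒-naturalʳ) assoc ⟩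
    pairing ∘ (id ⊗₁ ev) ∘ (id ⊗₁ (id ⊗₁ ⌜id⌝)) ∘ α⇒ ∘ ρ⇐ ≈⟨ refl⟩∘⟨ pullˡ (≈-sym homomorphismʳ) ⟩
    pairing ∘ (id ⊗₁ (ev ∘ (id ⊗₁ ⌜id⌝))) ∘ α⇒ ∘ ρ⇐       ≈⟨ refl⟩∘⟨ (≈-refl ⟩⊗⟨ curry-β) ⟩∘⟨refl ⟩
    pairing ∘ (id ⊗₁ ρ⇒) ∘ α⇒ ∘ ρ⇐                        ≈⟨ refl⟩∘⟨ pullˡ unitorʳ-α⇒ ⟩
    pairing ∘ ρ⇒ ∘ ρ⇐                                     ≈⟨ ≈-trans (refl⟩∘⟨ ρ-isoʳ) identityʳ ⟩
    pairing                                               ∎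

  trace-form-symmetric : IsSymmetricForm (form l)
  trace-form-symmetric = split-epi-cancel (inverse-⊗id mix-mix⁻¹) (begin
    (form l ∘ σ) ∘ (mixᴬ ⊗₁ id)                        ≈⟨ ≈-trans assoc (refl⟩∘⟨ σ-natural) ⟩
    form l ∘ (id ⊗₁ mixᴬ) ∘ σ                          ≈⟨ trace-form-via-trace ⟩∘⟨refl ⟩
    (trace ∘ μ) ∘ (id ⊗₁ mixᴬ) ∘ σ                     ≈⟨ ≈-trans assoc (refl⟩∘⟨ pullˡ icomp-mixʳ) ⟩
    trace ∘ (mixᴬ ∘ (dual-action ⊗₁ id) ∘ α⇐) ∘ σ      ≈⟨ refl⟩∘⟨ assoc² ⟩
    trace ∘ mixᴬ ∘ (dual-action ⊗₁ id) ∘ α⇐ ∘ σ        ≈⟨ pullˡ trace-mix ⟩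
    pairing ∘ (dual-action ⊗₁ id) ∘ α⇐ ∘ σ             ≈⟨ pairing-dual-action ⟩
    pairing ∘ (id ⊗₁ ev) ∘ α⇒                          ≈⟨ trace-form-mixˡ ⟨
    form l ∘ (mixᴬ ⊗₁ id)                              ∎)

mainTheorem1 : {o ℓ e : Level} (𝒱 : SMCC o ℓ e) → StarAutonomous 𝒱 →
    (A : SMCC.Obj 𝒱) → Nuclear 𝒱 A →
    Σ[ l ∈ SMCC._⇒_ 𝒱 (SMCC.[_,_] 𝒱 A A) (_* 𝒱 (SMCC.[_,_] 𝒱 A A)) ]
      IsFrobeniusStructure 𝒱 (SMCC.ev 𝒱) (icomp 𝒱 A) l l
mainTheorem1 𝒱 star-autonomous A nuclear =
  l , frobenius-from-form trace-form-symmetric trace-form-invariant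
        (star-autonomous [ A , A ]) icomp-assoc l-iso
  where
  open SMCC 𝒱 using ([_,_])
  open Endomorphisms 𝒱 A using (icomp-assoc)
  open FrobeniusForm 𝒱 using (frobenius-from-form)
  open TraceForm 𝒱 A (star-autonomous A) nuclear
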